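{- Let $C$ be a groupoid and $Q$ an involutive quantale. Then $Q^C$, with pointwise order and sups, convolution $\ast$, unit $\mathit{id}_0$ and involution $f^\circ(x)=(f(x^-))^\circ$, is an involutive quantale.
   Context: A catoid $(C,\odot,s,t)$ is a set with $\odot:C\times C\to\mathcal P C$ and $s,t:C\to C$ such that, with $X\odot Y=\bigcup_{x\in X,y\in Y}x\odot y$: $x\odot(y\odot z)=(x\odot y)\odot z$, $x\odot y\ne\emptyset\Rightarrow t(x)=s(y)$, $s(x)\odot x=\{x\}$, $x\odot t(x)=\{x\}$. A groupoid is a catoid with a map $(-)^-:C\to C$ such that $x\odot x^-=\{s(x)\}$ and $x^-\odot x=\{t(x)\}$ for all $x$. A quantale is a complete lattice with an associative multiplication preserving all sups in both arguments and having a unit $1$. An involutive quantale is a quantale with $(-)^\circ:Q\to Q$ satisfying $\alpha^{\circ\circ}=\alpha$, $(\bigvee A)^\circ=\bigvee\{\alpha^\circ\mid\alpha\in A\}$, $(\alpha\beta)^\circ=\beta^\circ\alpha^\circ$. On $Q^C$: $(f\ast g)(x)=\bigvee\{f(y)\cdot g(z)\mid x\in y\odot z\}$, and $\mathit{id}_0(x)=1$ if $s(x)=x$, $\bot$ otherwise. -}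

module Defs where

open import Level using (Level; suc)
open import Data.Product using (Σ; _×_; _,_)
open import Data.Empty.Polymorphic using (⊥)
open import Relation.Binary.PropositionalEquality using (_≡_)
open import Relation.Binary.Structures using (IsPartialOrder)
open import Function.Bundles using (_⇔_)

private variable ℓ : Level

-- Catoids and groupoids.  The powerset P C is rendered as predicates
-- C → Set ℓ; "w ∈ x ⊙ y" is the type  (x ⊙ y) w.

lift⊙ : {C : Set ℓ} → (C → C → C → Set ℓ) → (C → Set ℓ) → (C → Set ℓ) → C → Set ℓ
lift⊙ {C = C} _⊙_ X Y w = Σ C λ x → Σ C λ y → X x × Y y × (x ⊙ y) w

｛_｝ : {C : Set ℓ} → C → C → Set ℓ
｛ x ｝ w = w ≡ x

record IsCatoid {C : Set ℓ} (_⊙_ : C → C → C → Set ℓ) (s t : C → C) : Set ℓ where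
  field
    assoc : ∀ x y z w →
      lift⊙ _⊙_ ｛ x ｝ (y ⊙ z) w ⇔ lift⊙ _⊙_ (x ⊙ y) ｛ z ｝ w
    local : ∀ x y → Σ C (x ⊙ y) → t x ≡ s y
    s-unit : ∀ x w → (s x ⊙ x) w ⇔ (w ≡ x)
    t-unit : ∀ x w → (x ⊙ t x) w ⇔ (w ≡ x)

record Groupoid (ℓ : Level) : Set (suc ℓ) where
  field
    Carrier  : Set ℓ
    _⊙_      : Carrier → Carrier → Carrier → Set ℓ
    s t      : Carrier → Carrier
    isCatoid : IsCatoid _⊙_ s t
    _⁻       : Carrier → Carrier
    inv-r    : ∀ x w → (x ⊙ (x ⁻)) w ⇔ (w ≡ s x)
    inv-l    : ∀ x w → ((x ⁻) ⊙ x) w ⇔ (w ≡ t x)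

record IsInvolutiveQuantale {Q : Set ℓ} (_≈_ _≤_ : Q → Q → Set ℓ)
       (⋁ : {I : Set ℓ} → (I → Q) → Q) (_·_ : Q → Q → Q) (1# : Q)
       (_° : Q → Q) : Set (suc ℓ) where
  field
    isPartialOrder : IsPartialOrder _≈_ _≤_
    ⋁-upper : ∀ {I : Set ℓ} (f : I → Q) (i : I) → f i ≤ ⋁ f
    ⋁-least : ∀ {I : Set ℓ} (f : I → Q) (b : Q) → (∀ i → f i ≤ b) → ⋁ f ≤ b
    ·-cong   : ∀ {a a′ b b′} → a ≈ a′ → b ≈ b′ → (a · b) ≈ (a′ · b′)
    ·-assoc  : ∀ a b c → ((a · b) · c) ≈ (a · (b · c))
    ·-identityˡ : ∀ a → (1# · a) ≈ a
    ·-identityʳ : ∀ a → (a · 1#) ≈ a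
    ·-⋁ˡ : ∀ {I : Set ℓ} (f : I → Q) (b : Q) → (⋁ f · b) ≈ ⋁ (λ i → f i · b)
    ·-⋁ʳ : ∀ {I : Set ℓ} (a : Q) (f : I → Q) → (a · ⋁ f) ≈ ⋁ (λ i → a · f i)
    °-cong : ∀ {a b} → a ≈ b → (a °) ≈ (b °)
    °-invol : ∀ a → ((a °) °) ≈ a
    °-⋁ : ∀ {I : Set ℓ} (f : I → Q) → (⋁ f °) ≈ ⋁ (λ i → f i °)
    °-· : ∀ a b → ((a · b) °) ≈ ((b °) · (a °))

record InvolutiveQuantale (ℓ : Level) : Set (suc ℓ) where
  infixl 7 _·_
  field
    Carrier : Set ℓ
    _≈_ _≤_ : Carrier → Carrier → Set ℓ
    ⋁       : {I : Set ℓ} → (I → Carrier) → Carrier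
    _·_     : Carrier → Carrier → Carrier
    1#      : Carrier
    _°      : Carrier → Carrier
    isInvolutiveQuantale : IsInvolutiveQuantale _≈_ _≤_ ⋁ _·_ 1# _°

module FunctionSpace (C : Groupoid ℓ) (Q : InvolutiveQuantale ℓ) where
  open Groupoid C renaming (Carrier to Cc)
  open InvolutiveQuantale Q renaming (Carrier to Qc)

  QC : Set ℓ
  QC = Cc → Qc

  _≈ᶠ_ : QC → QC → Set ℓ
  f ≈ᶠ g = ∀ x → f x ≈ g x

  _≤ᶠ_ : QC → QC → Set ℓ
  f ≤ᶠ g = ∀ x → f x ≤ g x

  ⋁ᶠ : {I : Set ℓ} → (I → QC) → QC
  ⋁ᶠ F x = ⋁ (λ i → F i x)

  _∗_ : QC → QC → QC
  (f ∗ g) x = ⋁ {I = Σ Cc λ y → Σ Cc λ z → (y ⊙ z) x} λ where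
    (y , z , _) → f y · g z

  ⊥Q : Qc
  ⊥Q = ⋁ {I = ⊥} λ ()

  -- id₀(x) = 1 if s(x) = x, ⊥ otherwise; rendered constructively as
  -- the sup of {1 | s(x) = x}, which is 1 if s(x) = x and ⊥ otherwise.
  id₀ : QC
  id₀ x = ⋁ {I = s x ≡ x} (λ _ → 1#)

  _ᶠ° : QC → QC
  (f ᶠ°) x = (f (x ⁻)) °

{-# OPTIONS --safe #-}
-- In a groupoid, cancelling with inverses inside the associativity of ⊙ shows that
-- composition is single-valued and that x ↦ x⁻ reverses it.  The quantale laws of Q^C
-- then reduce to those of Q by reindexing sups: associativity along the bijection
-- between factorisations x = (y₁ y₂) z and x = y₁ (y₂ z), the involution along
-- (y , z) ↦ (z⁻ , y⁻), and the unit laws because y z = z when y is an identity.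
module Submission where

open import Level using (Level)
open import Data.Product using (Σ; ∃; _×_; _,_; proj₁; proj₂)
open import Function.Base using (_∘_)
open import Function.Bundles using (module Equivalence)
open import Relation.Binary.Bundles using (Setoid)
open import Relation.Binary.PropositionalEquality using (_≡_; refl; sym; trans; cong; cong₂; subst)
open import Relation.Binary.Structures using (IsPartialOrder)
open import Defs

private variable ℓ : Level

module CatoidProperties {C : Set ℓ} {_⊙_ : C → C → C → Set ℓ} {s t : C → C}
                        (isCatoid : IsCatoid _⊙_ s t) where
  open IsCatoid isCatoid

  ⊙-reassocˡ : ∀ {x y z a w} → (x ⊙ y) a → (a ⊙ z) w → ∃ λ b → (y ⊙ z) b × (x ⊙ b) w
  ⊙-reassocˡ {x} {y} {z} {a} {w} p q with Equivalence.from (assoc x y z w) (a , z , p , refl , q)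
  ... | _ , b , refl , r , u = b , r , u

  ⊙-reassocʳ : ∀ {x y z b w} → (y ⊙ z) b → (x ⊙ b) w → ∃ λ a → (x ⊙ y) a × (a ⊙ z) w
  ⊙-reassocʳ {x} {y} {z} {b} {w} p q with Equivalence.to (assoc x y z w) (x , b , refl , p , q)
  ... | a , _ , r , refl , u = a , r , u

  ⊙-local : ∀ {x y w} → (x ⊙ y) w → t x ≡ s y
  ⊙-local {x} {y} {w} p = local x y (w , p)

  x∈sx⊙x : ∀ x → (s x ⊙ x) x
  x∈sx⊙x x = Equivalence.from (s-unit x x) refl

  x∈x⊙tx : ∀ x → (x ⊙ t x) x
  x∈x⊙tx x = Equivalence.from (t-unit x x) refl

  ⊙-unitˡ : ∀ {e x w} → (e ⊙ x) w → e ≡ s x → w ≡ x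
  ⊙-unitˡ {x = x} {w} p refl = Equivalence.to (s-unit x w) p

  ⊙-unitʳ : ∀ {x e w} → (x ⊙ e) w → e ≡ t x → w ≡ x
  ⊙-unitʳ {x} {w = w} p refl = Equivalence.to (t-unit x w) p

  t-s≡s : ∀ x → t (s x) ≡ s x
  t-s≡s x = ⊙-local (x∈sx⊙x x)

  s-t≡t : ∀ x → s (t x) ≡ t x
  s-t≡t x = sym (⊙-local (x∈x⊙tx x))

  s-s≡s : ∀ x → s (s x) ≡ s x
  s-s≡s x = trans (cong s (sym (t-s≡s x))) (trans (s-t≡t (s x)) (t-s≡s x))

  t-⊙ : ∀ {y z w} → (y ⊙ z) w → t w ≡ t z
  t-⊙ {w = w} p with ⊙-reassocˡ p (x∈x⊙tx w)
  ... | _ , r , _ = trans (sym (s-t≡t w)) (sym (⊙-local r))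

  ⊙-identityˡ : ∀ {e z x} → s e ≡ e → (e ⊙ z) x → x ≡ z
  ⊙-identityˡ {e} e-fixed p = ⊙-unitˡ p (trans (sym t-e≡e) (⊙-local p))
    where
    t-e≡e : t e ≡ e
    t-e≡e = trans (cong t (sym e-fixed)) (trans (t-s≡s e) e-fixed)

  ⊙-identityʳ : ∀ {y e x} → s e ≡ e → (y ⊙ e) x → x ≡ y
  ⊙-identityʳ e-fixed p = ⊙-unitʳ p (trans (sym e-fixed) (sym (⊙-local p)))

module GroupoidProperties (G : Groupoid ℓ) where
  open Groupoid G
  open CatoidProperties isCatoid

  sx∈x⊙x⁻ : ∀ x → (x ⊙ (x ⁻)) (s x)
  sx∈x⊙x⁻ x = Equivalence.from (inv-r x (s x)) refl

  tx∈x⁻⊙x : ∀ x → ((x ⁻) ⊙ x) (t x)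
  tx∈x⁻⊙x x = Equivalence.from (inv-l x (t x)) refl

  x⊙x⁻≡s : ∀ {x w} → (x ⊙ (x ⁻)) w → w ≡ s x
  x⊙x⁻≡s {x} {w} = Equivalence.to (inv-r x w)

  x⁻⊙x≡t : ∀ {x w} → ((x ⁻) ⊙ x) w → w ≡ t x
  x⁻⊙x≡t {x} {w} = Equivalence.to (inv-l x w)

  t-⁻≡s : ∀ x → t (x ⁻) ≡ s x
  t-⁻≡s x = ⊙-local (tx∈x⁻⊙x x)

  s-⁻≡t : ∀ x → s (x ⁻) ≡ t x
  s-⁻≡t x = sym (⊙-local (sx∈x⊙x⁻ x))

  ⊙-cancel : ∀ {x y z a w} → (∀ {b} → (y ⊙ z) b → b ≡ t x) → (x ⊙ y) a → (a ⊙ z) w → w ≡ x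
  ⊙-cancel yz≡tx p q with ⊙-reassocˡ p q
  ... | _ , r , u = ⊙-unitʳ u (yz≡tx r)

  ⊙-divʳ : ∀ {y z w} → (y ⊙ z) w → (w ⊙ (z ⁻)) y
  ⊙-divʳ {y} {z} {w} p with ⊙-reassocʳ (tx∈x⁻⊙x z) (subst (λ e → (w ⊙ e) w) (t-⊙ p) (x∈x⊙tx w))
  ... | a , r , _ = subst (w ⊙ (z ⁻)) a≡y r
    where
    a≡y : a ≡ y
    a≡y = ⊙-cancel (λ q → trans (x⊙x⁻≡s q) (sym (⊙-local p))) p r

  ⊙-functional : ∀ {y z w w′} → (y ⊙ z) w → (y ⊙ z) w′ → w′ ≡ w
  ⊙-functional p = ⊙-cancel (λ q → trans (x⁻⊙x≡t q) (sym (t-⊙ p))) (⊙-divʳ p)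

  ⊙-divˡ : ∀ {y z w} → (y ⊙ z) w → ((y ⁻) ⊙ w) z
  ⊙-divˡ {y} {z} p with ⊙-reassocˡ (tx∈x⁻⊙x y) (subst (λ e → (e ⊙ z) z) (sym (⊙-local p)) (x∈sx⊙x z))
  ... | _ , r , u = subst (λ b → ((y ⁻) ⊙ b) z) (⊙-functional p r) u

  ⁻-involutive : ∀ x → ((x ⁻) ⁻) ≡ x
  ⁻-involutive x = sym (⊙-cancel x⁻⊙x≡t⁻⁻ sx∈x⁻⁻⊙x⁻ (x∈sx⊙x x))
    where
    x⁻⊙x≡t⁻⁻ : ∀ {b} → ((x ⁻) ⊙ x) b → b ≡ t ((x ⁻) ⁻)
    x⁻⊙x≡t⁻⁻ q = trans (x⁻⊙x≡t q) (sym (trans (t-⁻≡s (x ⁻)) (s-⁻≡t x)))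
    sx∈x⁻⁻⊙x⁻ : (((x ⁻) ⁻) ⊙ (x ⁻)) (s x)
    sx∈x⁻⁻⊙x⁻ = subst (((x ⁻) ⁻) ⊙ (x ⁻)) (t-⁻≡s x) (tx∈x⁻⊙x (x ⁻))

  -- w = y z gives w z⁻ = y, then w⁻ y = z⁻, then z⁻ y⁻ = w⁻.
  ⁻-anti : ∀ {y z w} → (y ⊙ z) w → ((z ⁻) ⊙ (y ⁻)) (w ⁻)
  ⁻-anti = ⊙-divʳ ∘ ⊙-divˡ ∘ ⊙-divʳ

module SupProperties (Q : InvolutiveQuantale ℓ) where
  open InvolutiveQuantale Q
  open IsInvolutiveQuantale isInvolutiveQuantale
  open IsPartialOrder isPartialOrder
    using (antisym; module Eq) renaming (trans to ≤-trans; refl to ≤-refl; reflexive to ≤-reflexive)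

  ⋁-mono : ∀ {I J : Set ℓ} {f : I → Carrier} {g : J → Carrier} →
           (∀ i → ∃ λ j → f i ≤ g j) → ⋁ f ≤ ⋁ g
  ⋁-mono {g = g} f≤g = ⋁-least _ _ λ i → let j , fi≤gj = f≤g i in ≤-trans fi≤gj (⋁-upper g j)

  ⋁-cong : ∀ {I : Set ℓ} {f g : I → Carrier} → (∀ i → f i ≈ g i) → ⋁ f ≈ ⋁ g
  ⋁-cong f≈g = antisym (⋁-mono λ i → i , ≤-reflexive (f≈g i)) (⋁-mono λ i → i , ≤-reflexive (Eq.sym (f≈g i)))

  ⋁⋁-upper : ∀ {I : Set ℓ} {J : I → Set ℓ} (F : (i : I) → J i → Carrier) i j →
             F i j ≤ ⋁ (λ i → ⋁ (F i))
  ⋁⋁-upper F i j = ≤-trans (⋁-upper (F i) j) (⋁-upper (λ i → ⋁ (F i)) i)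

  ⋁⋁-mono : ∀ {I : Set ℓ} {J : I → Set ℓ} {K : Set ℓ} {L : K → Set ℓ}
            {F : (i : I) → J i → Carrier} {G : (k : K) → L k → Carrier} →
            (∀ i j → ∃ λ k → ∃ λ l → F i j ≤ G k l) →
            ⋁ (λ i → ⋁ (F i)) ≤ ⋁ (λ k → ⋁ (G k))
  ⋁⋁-mono {G = G} F≤G = ⋁-least _ _ λ i → ⋁-least _ _ λ j →
    let k , l , Fij≤Gkl = F≤G i j
    in ≤-trans Fij≤Gkl (⋁⋁-upper G k l)

  ⋁-swap : ∀ {I J : Set ℓ} (F : I → J → Carrier) →
           ⋁ (λ i → ⋁ (λ j → F i j)) ≈ ⋁ (λ j → ⋁ (λ i → F i j))
  ⋁-swap F = antisym (⋁⋁-mono λ i j → j , i , ≤-refl) (⋁⋁-mono λ j i → i , j , ≤-refl)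

module FunctionSpaceProperties (C : Groupoid ℓ) (Q : InvolutiveQuantale ℓ) where
  open Groupoid C renaming (Carrier to Cc)
  open InvolutiveQuantale Q renaming (Carrier to Qc)
  open IsInvolutiveQuantale isInvolutiveQuantale
  open IsPartialOrder isPartialOrder
    using (antisym; isEquivalence; module Eq) renaming (refl to ≤-refl; trans to ≤-trans; reflexive to ≤-reflexive)
  open FunctionSpace C Q
  open CatoidProperties isCatoid
  open GroupoidProperties C
  open SupProperties Q

  Q-setoid : Setoid ℓ ℓ
  Q-setoid = record { isEquivalence = isEquivalence }

  open import Relation.Binary.Reasoning.Setoid Q-setoid
  open import Relation.Binary.Indexed.Homogeneous.Structures {I = Cc} (λ _ → Qc) _≈_
    using (IsIndexedPartialOrder)

  Factorisation : Cc → Set ℓ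
  Factorisation x = Σ Cc λ y → Σ Cc λ z → (y ⊙ z) x

  _⊗_ : QC → QC → ∀ {x} → Factorisation x → Qc
  (f ⊗ g) (y , z , _) = f y · g z

  ≤ᶠ-isPartialOrder : IsPartialOrder _≈ᶠ_ _≤ᶠ_
  ≤ᶠ-isPartialOrder = IsIndexedPartialOrder.isPartialOrder record
    { isPreorderᵢ = record
      { isEquivalenceᵢ = record { reflᵢ = Eq.refl ; symᵢ = Eq.sym ; transᵢ = Eq.trans }
      ; reflexiveᵢ = ≤-reflexive
      ; transᵢ = ≤-trans
      }
    ; antisymᵢ = antisym
    }

  ∗-cong : ∀ {f f′ g g′} → f ≈ᶠ f′ → g ≈ᶠ g′ → (f ∗ g) ≈ᶠ (f′ ∗ g′)
  ∗-cong f≈f′ g≈g′ x = ⋁-cong λ (y , z , _) → ·-cong (f≈f′ y) (g≈g′ z)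

  ∗-⋁ˡ : ∀ {I : Set ℓ} (F : I → QC) g → (⋁ᶠ F ∗ g) ≈ᶠ ⋁ᶠ (λ i → F i ∗ g)
  ∗-⋁ˡ F g x = Eq.trans (⋁-cong λ (y , z , _) → ·-⋁ˡ (λ i → F i y) (g z)) (⋁-swap _)

  ∗-⋁ʳ : ∀ {I : Set ℓ} f (G : I → QC) → (f ∗ ⋁ᶠ G) ≈ᶠ ⋁ᶠ (λ i → f ∗ G i)
  ∗-⋁ʳ f G x = Eq.trans (⋁-cong λ (y , z , _) → ·-⋁ʳ (f y) (λ i → G i z)) (⋁-swap _)

  ∗-assoc : ∀ f g h → ((f ∗ g) ∗ h) ≈ᶠ (f ∗ (g ∗ h))
  ∗-assoc f g h x = begin
    ((f ∗ g) ∗ h) x              ≈⟨ ⋁-cong (λ (_ , z , _) → ·-⋁ˡ _ (h z)) ⟩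
    ⋁ (λ a → ⋁ (leftNested a))   ≈⟨ antisym (⋁⋁-mono regroupʳ) (⋁⋁-mono regroupˡ) ⟩
    ⋁ (λ a → ⋁ (rightNested a))  ≈⟨ ⋁-cong (λ (y , _ , _) → ·-⋁ʳ (f y) _) ⟨
    (f ∗ (g ∗ h)) x              ∎
    where
    leftNested : (a : Factorisation x) → Factorisation (proj₁ a) → Qc
    leftNested (_ , z , _) (y₁ , y₂ , _) = f y₁ · g y₂ · h z

    rightNested : (a : Factorisation x) → Factorisation (proj₁ (proj₂ a)) → Qc
    rightNested (y , _ , _) (z₁ , z₂ , _) = f y · (g z₁ · h z₂)

    regroupʳ : ∀ a b → ∃ λ c → ∃ λ d → leftNested a b ≤ rightNested c d
    regroupʳ (_ , _ , p) (y₁ , y₂ , q) =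
      let b , r , u = ⊙-reassocˡ q p in (y₁ , b , u) , (y₂ , _ , r) , ≤-reflexive (·-assoc _ _ _)

    regroupˡ : ∀ c d → ∃ λ a → ∃ λ b → rightNested c d ≤ leftNested a b
    regroupˡ (_ , _ , p) (z₁ , z₂ , q) =
      let a , r , u = ⊙-reassocʳ q p in (a , z₂ , u) , (_ , z₁ , r) , ≤-reflexive (Eq.sym (·-assoc _ _ _))

  ∗-identityˡ : ∀ f → (id₀ ∗ f) ≈ᶠ f
  ∗-identityˡ f x = Eq.trans (⋁-cong λ (_ , z , _) → ·-⋁ˡ _ (f z)) (antisym upper lower)
    where
    term : (a : Factorisation x) → s (proj₁ a) ≡ proj₁ a → Qc
    term (_ , z , _) _ = 1# · f z

    upper : ⋁ (λ a → ⋁ (term a)) ≤ f x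
    upper = ⋁-least _ _ λ (_ , z , p) → ⋁-least _ _ λ y-identity →
      ≤-reflexive (Eq.trans (·-identityˡ (f z)) (Eq.reflexive (cong f (sym (⊙-identityˡ y-identity p)))))

    lower : f x ≤ ⋁ (λ a → ⋁ (term a))
    lower = ≤-trans (≤-reflexive (Eq.sym (·-identityˡ (f x)))) (⋁⋁-upper term (s x , x , x∈sx⊙x x) (s-s≡s x))

  ∗-identityʳ : ∀ f → (f ∗ id₀) ≈ᶠ f
  ∗-identityʳ f x = Eq.trans (⋁-cong λ (y , _ , _) → ·-⋁ʳ (f y) _) (antisym upper lower)
    where
    term : (a : Factorisation x) → s (proj₁ (proj₂ a)) ≡ proj₁ (proj₂ a) → Qc
    term (y , _ , _) _ = f y · 1#

    upper : ⋁ (λ a → ⋁ (term a)) ≤ f x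
    upper = ⋁-least _ _ λ (y , _ , p) → ⋁-least _ _ λ z-identity →
      ≤-reflexive (Eq.trans (·-identityʳ (f y)) (Eq.reflexive (cong f (sym (⊙-identityʳ z-identity p)))))

    lower : f x ≤ ⋁ (λ a → ⋁ (term a))
    lower = ≤-trans (≤-reflexive (Eq.sym (·-identityʳ (f x)))) (⋁⋁-upper term (x , t x , x∈x⊙tx x) (s-t≡t x))

  ᶠ°-involutive : ∀ f → ((f ᶠ°) ᶠ°) ≈ᶠ f
  ᶠ°-involutive f x = Eq.trans (°-invol _) (Eq.reflexive (cong f (⁻-involutive x)))

  ᶠ°-∗ : ∀ f g → ((f ∗ g) ᶠ°) ≈ᶠ ((g ᶠ°) ∗ (f ᶠ°))
  ᶠ°-∗ f g x = begin
    ((f ∗ g) ᶠ°) x        ≈⟨ °-⋁ _ ⟩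
    ⋁ (λ (a : Factorisation (x ⁻)) → (f ⊗ g) a °)
                          ≈⟨ ⋁-cong (λ (y , z , _) → °-· (f y) (g z)) ⟩
    ⋁ reversed            ≈⟨ antisym (⋁-mono reverse) (⋁-mono unreverse) ⟩
    ((g ᶠ°) ∗ (f ᶠ°)) x   ∎
    where
    reversed : Factorisation (x ⁻) → Qc
    reversed (y , z , _) = g z ° · f y °

    reverse : ∀ a → ∃ λ (c : Factorisation x) → reversed a ≤ ((g ᶠ°) ⊗ (f ᶠ°)) c
    reverse (y , z , p) = (z ⁻ , y ⁻ , subst ((z ⁻) ⊙ (y ⁻)) (⁻-involutive x) (⁻-anti p)) ,
      ≤-reflexive (Eq.reflexive (cong₂ (λ u v → g u ° · f v °) (sym (⁻-involutive z)) (sym (⁻-involutive y))))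

    unreverse : ∀ c → ∃ λ a → ((g ᶠ°) ⊗ (f ᶠ°)) c ≤ reversed a
    unreverse (u , v , q) = (v ⁻ , u ⁻ , ⁻-anti q) , ≤-refl

proposition9p1 : {ℓ : Level} (C : Groupoid ℓ) (Q : InvolutiveQuantale ℓ) →
    let open FunctionSpace C Q in
    IsInvolutiveQuantale _≈ᶠ_ _≤ᶠ_ ⋁ᶠ _∗_ id₀ _ᶠ°
proposition9p1 C Q = record
  { isPartialOrder = ≤ᶠ-isPartialOrder
  ; ⋁-upper        = λ F i x → ⋁-upper (λ j → F j x) i
  ; ⋁-least        = λ F b F≤b x → ⋁-least (λ i → F i x) (b x) (λ i → F≤b i x)
  ; ·-cong         = ∗-cong
  ; ·-assoc        = ∗-assoc
  ; ·-identityˡ    = ∗-identityˡ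
  ; ·-identityʳ    = ∗-identityʳ
  ; ·-⋁ˡ           = ∗-⋁ˡ
  ; ·-⋁ʳ           = ∗-⋁ʳ
  ; °-cong         = λ f≈g x → °-cong (f≈g (x ⁻))
  ; °-invol        = ᶠ°-involutive
  ; °-⋁            = λ F x → °-⋁ (λ i → F i (x ⁻))
  ; °-·            = ᶠ°-∗
  }
  where
  open Groupoid C using (_⁻)
  open InvolutiveQuantale Q using (isInvolutiveQuantale)
  open IsInvolutiveQuantale isInvolutiveQuantale using (⋁-upper; ⋁-least; °-cong; °-⋁)
  open FunctionSpaceProperties C Q
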